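{- Let $n\ge1$ be an integer. For $j\in\{1,\dots,n\}$ let $\pi_j\in\{0,1\}^n$ be the vector with $1$ in coordinate $j$ and $0$ elsewhere, and let addition in $\{0,1\}^n=\mathbb{Z}_2^n$ be coordinatewise mod $2$. Consider the homogeneous linear system in the real unknowns $M(\gamma)$, $\gamma\in\{0,1\}^n$: \[\sum_{\substack{(j,k)\in\{1,\dots,n\}^2\\ j-k\equiv d \pmod n}} M(\gamma+\pi_j+\pi_k)=0\qquad\text{for every integer }1\le d\le n/2\text{ and every }\gamma\in\{0,1\}^n.\] Then there exists no $n\times n$ circulant real Hadamard matrix if and only if the only solution of this system is $M(\gamma)=0$ for all $\gamma$.
   Context: A real Hadamard matrix is a square $\pm1$ matrix with pairwise orthogonal rows. An $n\times n$ matrix $C$ is circulant if there is a vector $x$ with $c_{i,j}=x_{j-i+1}$, the index reduced modulo $n$ to $\{1,\dots,n\}$.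
   Formalization: The unknowns M(γ) of the homogeneous linear system take values in the rationals rather than the reals. -}

module Defs where

open import Data.Nat as ℕ using (ℕ; zero; suc; NonZero)
open import Data.Nat.DivMod using (_%_; m%n<n)
open import Data.Fin using (Fin; toℕ; _≟_)
import Data.Fin as Fin
open import Data.Bool using (Bool; _xor_; if_then_else_)
open import Data.Vec using (Vec; tabulate; zipWith)
open import Data.Integer as ℤ using (ℤ)
open import Data.Rational as ℚ using (ℚ)
open import Data.Product using (_×_)
open import Data.Sum using (_⊎_)
open import Relation.Nullary using (¬_)
open import Relation.Nullary.Decidable using (⌊_⌋)
open import Relation.Binary.PropositionalEquality using (_≡_)

Σℤ : (n : ℕ) → (Fin n → ℤ) → ℤ
Σℤ zero    f = ℤ.0ℤ
Σℤ (suc n) f = f Fin.zero ℤ.+ Σℤ n (λ i → f (Fin.suc i))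

Σℚ : (n : ℕ) → (Fin n → ℚ) → ℚ
Σℚ zero    f = ℚ.0ℚ
Σℚ (suc n) f = f Fin.zero ℚ.+ Σℚ n (λ i → f (Fin.suc i))

diffMod : {n : ℕ} → Fin n → Fin n → ℕ
diffMod {zero}  b a = 0
diffMod {suc n} b a = (toℕ b ℕ.+ (suc n ℕ.∸ toℕ a)) % suc n

-- circulant matrix generated by x : c i j = x ((j - i) mod n)   (0-based version of x_{j-i+1})
circulant : {n : ℕ} → (Fin n → ℤ) → Fin n → Fin n → ℤ
circulant {zero}  x i j = ℤ.0ℤ
circulant {suc n} x i j = x (Fin.fromℕ< (m%n<n (toℕ j ℕ.+ (suc n ℕ.∸ toℕ i)) (suc n)))

IsHadamard : (n : ℕ) → (Fin n → Fin n → ℤ) → Set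
IsHadamard n H =
  ((i j : Fin n) → (H i j ≡ ℤ.1ℤ) ⊎ (H i j ≡ ℤ.-1ℤ)) ×
  ((i i' : Fin n) → ¬ (i ≡ i') → Σℤ n (λ k → H i k ℤ.* H i' k) ≡ ℤ.0ℤ)

data CirculantHadamardExists (n : ℕ) : Set where
  witness : (x : Fin n → ℤ) → IsHadamard n (circulant x) → CirculantHadamardExists n

Z2n : ℕ → Set
Z2n n = Vec Bool n

_⊕_ : {n : ℕ} → Z2n n → Z2n n → Z2n n
_⊕_ = zipWith _xor_

π : {n : ℕ} → Fin n → Z2n n
π j = tabulate (λ i → ⌊ i ≟ j ⌋)

systemLHS : (n : ℕ) → (Z2n n → ℚ) → ℕ → Z2n n → ℚ
systemLHS n M d γ =
  Σℚ n (λ j → Σℚ n (λ k →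
    if ⌊ diffMod j k ℕ.≟ d ⌋ then M ((γ ⊕ π j) ⊕ π k) else ℚ.0ℚ))
  -- (d is only used with 1 ≤ d, 2d ≤ n, so d < n and "j - k ≡ d mod n" is "diffMod j k = d")

{-# OPTIONS --safe #-}

-- Take the Walsh transform M̂(s) = Σ_γ (-1)^(s·γ) M(γ) on ℤ₂ⁿ. Translation by π_j + π_k multiplies
-- M̂(s) by (-1)^(s_j + s_k), so the equation indexed by d becomes c_s(d) · M̂(s) = 0, where c_s is the
-- periodic autocorrelation of the ±1 sequence x_k = (-1)^(s_k). Rows i, i′ of the circulant matrix with
-- first row x have inner product c(i - i′), and c(e) = c(n - e); so that matrix is Hadamard exactly when
-- c_s(d) = 0 for 1 ≤ d ≤ n/2. Without a circulant Hadamard matrix every s therefore has a d with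
-- c_s(d) ≠ 0, which forces M̂ = 0 and hence M = 0. Conversely, if (-1)^s is the first row of a
-- circulant Hadamard matrix, the character γ ↦ (-1)^(s·γ) is a nonzero solution.

module Submission where

open import Defs
open import Algebra.Bundles using (CommutativeRing)
import Algebra.Properties.CommutativeSemigroup as CommutativeSemigroupProperties
import Algebra.Properties.Semiring.Sum as SemiringSum
open import Data.Bool using (Bool; true; false; not; _∧_; _xor_; if_then_else_)
open import Data.Bool.Properties
  using (∧-identityʳ; ∧-zeroʳ; ∧-distribˡ-xor; xor-assoc; xor-same; xor-identityʳ; xor-∧-commutativeRing)
open import Data.Empty using (⊥-elim)
open import Data.Fin as Fin using (Fin; toℕ)
open import Data.Fin.Permutation using (permutation)
import Data.Fin.Properties as FinP
open import Data.Integer as ℤ using (ℤ; 0ℤ)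
import Data.Integer.Properties as ℤP
open import Data.Nat as ℕ using (ℕ; zero; suc; _∸_; _≤_; _<_; _*_)
open import Data.Nat.DivMod using (_%_; m%n<n; m%n%n≡m%n; %-distribˡ-+; [m+n]%n≡m%n; m<n⇒m%n≡m; n%n≡0)
import Data.Nat.Properties as ℕP
open import Data.Product using (_×_; _,_; proj₁; proj₂; Σ-syntax)
open import Data.Rational as ℚ using (ℚ; 0ℚ; 1ℚ)
open import Data.Rational.Literals using (fromℤ)
import Data.Rational.Properties as ℚP
open import Data.Rational.Solver using (module +-*-Solver)
import Data.Rational.Unnormalised as ℚᵘ
import Data.Rational.Unnormalised.Properties as ℚᵘP
open import Data.Sum using (_⊎_; inj₁; inj₂)
open import Data.Vec using ([]; _∷_; lookup; tabulate; replicate)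
open import Data.Vec.Functional using (removeAt)
open import Data.Vec.Properties using (tabulate-cong; zipWith-assoc; lookup∘tabulate)
open import Function using (_∘_)
open import Function.Bundles using (_⇔_; mk⇔; Equivalence)
open import Relation.Binary.PropositionalEquality
open import Relation.Nullary using (¬_; yes; no)
open import Relation.Nullary.Decidable using (⌊_⌋; ⌊⌋-map′)
open import Relation.Unary using (Decidable)

module ℚΣ = SemiringSum (CommutativeRing.semiring ℚP.+-*-commutativeRing)
module ℤΣ = SemiringSum ℤP.+-*-semiring
open CommutativeSemigroupProperties (CommutativeRing.+-commutativeSemigroup xor-∧-commutativeRing)
  using () renaming (interchange to xor-interchange)
open CommutativeSemigroupProperties (CommutativeRing.+-commutativeSemigroup ℚP.+-*-commutativeRing)
  using () renaming (interchange to ℚ-interchange)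
open CommutativeSemigroupProperties (CommutativeRing.*-commutativeSemigroup ℚP.+-*-commutativeRing)
  using () renaming (xy∙z≈y∙xz to ℚ-xy∙z≈y∙xz)
open CommutativeSemigroupProperties ℕP.+-commutativeSemigroup
  using () renaming (x∙yz≈y∙xz to ℕ-x∙yz≈y∙xz)

p*q≡0⇒q≢0⇒p≡0 : ∀ {p q} → p ℚ.* q ≡ 0ℚ → q ≢ 0ℚ → p ≡ 0ℚ
p*q≡0⇒q≢0⇒p≡0 {p} {q} p*q≡0 q≢0 = begin
  p                        ≡⟨ ℚP.*-identityʳ p ⟨
  p ℚ.* 1ℚ                 ≡⟨ cong (p ℚ.*_) (ℚP.*-inverseʳ q) ⟨
  p ℚ.* (q ℚ.* ℚ.1/ q)     ≡⟨ ℚP.*-assoc p q (ℚ.1/ q) ⟨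
  (p ℚ.* q) ℚ.* ℚ.1/ q     ≡⟨ cong (ℚ._* ℚ.1/ q) p*q≡0 ⟩
  0ℚ ℚ.* ℚ.1/ q            ≡⟨ ℚP.*-zeroˡ (ℚ.1/ q) ⟩
  0ℚ                       ∎
  where
  open ≡-Reasoning
  instance
    q-nonZero : ℚ.NonZero q
    q-nonZero = ℚ.≢-nonZero q≢0

sum-and-difference≡0 : ∀ a b → a ℚ.+ b ≡ 0ℚ → a ℚ.+ ℚ.- 1ℚ ℚ.* b ≡ 0ℚ → a ≡ 0ℚ × b ≡ 0ℚ
sum-and-difference≡0 a b a+b≡0 a−b≡0 = a≡0 , b≡0
  where
  open ≡-Reasoning
  open +-*-Solver
  a≡0 : a ≡ 0ℚ
  a≡0 = begin
    a ≡⟨ solve 2 (λ a b → a := con ℚ.½ :* ((a :+ b) :+ (a :+ con (ℚ.- 1ℚ) :* b))) refl a b ⟩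
    ℚ.½ ℚ.* ((a ℚ.+ b) ℚ.+ (a ℚ.+ ℚ.- 1ℚ ℚ.* b))
      ≡⟨ cong₂ (λ x y → ℚ.½ ℚ.* (x ℚ.+ y)) a+b≡0 a−b≡0 ⟩
    0ℚ ∎
  b≡0 : b ≡ 0ℚ
  b≡0 = begin
    b ≡⟨ solve 2 (λ a b → b := con ℚ.½ :* ((a :+ b) :- (a :+ con (ℚ.- 1ℚ) :* b))) refl a b ⟩
    ℚ.½ ℚ.* ((a ℚ.+ b) ℚ.- (a ℚ.+ ℚ.- 1ℚ ℚ.* b))
      ≡⟨ cong₂ (λ x y → ℚ.½ ℚ.* (x ℚ.- y)) a+b≡0 a−b≡0 ⟩
    0ℚ ∎

Σℚ≡sum : ∀ n (f : Fin n → ℚ) → Σℚ n f ≡ ℚΣ.sum f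
Σℚ≡sum zero    f = refl
Σℚ≡sum (suc n) f = cong (f Fin.zero ℚ.+_) (Σℚ≡sum n (f ∘ Fin.suc))

Σℤ≡sum : ∀ n (f : Fin n → ℤ) → Σℤ n f ≡ ℤΣ.sum f
Σℤ≡sum zero    f = refl
Σℤ≡sum (suc n) f = cong (ℤ._+_ (f Fin.zero)) (Σℤ≡sum n (f ∘ Fin.suc))

*-distribˡ-sum² : ∀ {m n} c (f : Fin m → Fin n → ℚ) →
  c ℚ.* (ℚΣ.sum λ j → ℚΣ.sum (f j)) ≡ (ℚΣ.sum λ j → ℚΣ.sum λ k → c ℚ.* f j k)
*-distribˡ-sum² c f =
  trans (ℚΣ.*-distribˡ-sum c (λ j → ℚΣ.sum (f j))) (ℚΣ.sum-cong-≗ λ j → ℚΣ.*-distribˡ-sum c (f j))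

*-distribʳ-sum² : ∀ {m n} c (f : Fin m → Fin n → ℚ) →
  (ℚΣ.sum λ j → ℚΣ.sum (f j)) ℚ.* c ≡ (ℚΣ.sum λ j → ℚΣ.sum λ k → f j k ℚ.* c)
*-distribʳ-sum² c f =
  trans (ℚΣ.*-distribʳ-sum c (λ j → ℚΣ.sum (f j))) (ℚΣ.sum-cong-≗ λ j → ℚΣ.*-distribʳ-sum c (f j))

sum-select : ∀ {n} {P : Fin n → Set} (P? : Decidable P) (g : Fin n → ℚ) {i} →
  (∀ {j} → P j → j ≡ i) → P i → ℚΣ.sum (λ j → if ⌊ P? j ⌋ then g j else 0ℚ) ≡ g i
sum-select {suc n} {P} P? g {i} unique Pi = begin
  ℚΣ.sum t                               ≡⟨ ℚΣ.sum-remove {i = i} t ⟩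
  t i ℚ.+ ℚΣ.sum (removeAt t i)          ≡⟨ cong₂ ℚ._+_ t-at-i (trans (ℚΣ.sum-cong-≗ t-elsewhere)
                                                                    (ℚΣ.sum-replicate-zero n)) ⟩
  g i ℚ.+ 0ℚ                             ≡⟨ ℚP.+-identityʳ (g i) ⟩
  g i                                    ∎
  where
  open ≡-Reasoning
  t : Fin (suc n) → ℚ
  t j = if ⌊ P? j ⌋ then g j else 0ℚ
  t-at-i : t i ≡ g i
  t-at-i with P? i
  ... | yes _  = refl
  ... | no ¬Pi = ⊥-elim (¬Pi Pi)
  t-elsewhere : ∀ j → removeAt t i j ≡ 0ℚ
  t-elsewhere j with P? (Fin.punchIn i j)
  ... | yes P[j′] = ⊥-elim (FinP.punchInᵢ≢i i j (unique P[j′]))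
  ... | no  _     = refl

fromℤ-+ : ∀ a b → fromℤ (a ℤ.+ b) ≡ fromℤ a ℚ.+ fromℤ b
fromℤ-+ a b = ℚP.toℚᵘ-injective
  (ℚᵘP.≃-trans (ℚᵘ.*≡* cross-multiplied) (ℚᵘP.≃-sym (ℚP.toℚᵘ-homo-+ (fromℤ a) (fromℤ b))))
  where
  cross-multiplied : (a ℤ.+ b) ℤ.* ℤ.1ℤ ≡ (a ℤ.* ℤ.1ℤ ℤ.+ b ℤ.* ℤ.1ℤ) ℤ.* ℤ.1ℤ
  cross-multiplied = cong (ℤ._* ℤ.1ℤ) (sym (cong₂ ℤ._+_ (ℤP.*-identityʳ a) (ℤP.*-identityʳ b)))

fromℤ-sum : ∀ {n} (f : Fin n → ℤ) → fromℤ (ℤΣ.sum f) ≡ ℚΣ.sum (fromℤ ∘ f)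
fromℤ-sum {zero}  f = refl
fromℤ-sum {suc n} f = trans (fromℤ-+ (f Fin.zero) (ℤΣ.sum (f ∘ Fin.suc)))
                            (cong (fromℤ (f Fin.zero) ℚ.+_) (fromℤ-sum (f ∘ Fin.suc)))

fromℤ-injective : ∀ {a b} → fromℤ a ≡ fromℤ b → a ≡ b
fromℤ-injective = cong ℚ.numerator

sign : Bool → ℚ
sign false = 1ℚ
sign true  = ℚ.- 1ℚ

sign-xor : ∀ a b → sign (a xor b) ≡ sign a ℚ.* sign b
sign-xor false false = refl
sign-xor false true  = refl
sign-xor true  false = refl
sign-xor true  true  = refl

sign-not : ∀ b → sign (not b) ≡ ℚ.- 1ℚ ℚ.* sign b
sign-not false = refl
sign-not true  = refl

sign≢0 : ∀ b → sign b ≢ 0ℚ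
sign≢0 false ()
sign≢0 true  ()

IsSign : ℤ → Set
IsSign z = z ≡ ℤ.1ℤ ⊎ z ≡ ℤ.-1ℤ

signℤ : Bool → ℤ
signℤ false = ℤ.1ℤ
signℤ true  = ℤ.-1ℤ

signℤ-isSign : ∀ b → IsSign (signℤ b)
signℤ-isSign false = inj₁ refl
signℤ-isSign true  = inj₂ refl

isSign⇒≡signℤ : ∀ {z} → IsSign z → z ≡ signℤ ⌊ z ℤ.≟ ℤ.-1ℤ ⌋
isSign⇒≡signℤ (inj₁ refl) = refl
isSign⇒≡signℤ (inj₂ refl) = refl

sign-xor≡fromℤ : ∀ a b → sign (a xor b) ≡ fromℤ (signℤ a ℤ.* signℤ b)
sign-xor≡fromℤ false false = refl
sign-xor≡fromℤ false true  = refl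
sign-xor≡fromℤ true  false = refl
sign-xor≡fromℤ true  true  = refl

signs : ∀ {n} → Z2n n → Fin n → ℤ
signs s k = signℤ (lookup s k)

dot : ∀ {n} → Z2n n → Z2n n → Bool
dot []      []      = false
dot (b ∷ s) (c ∷ γ) = (b ∧ c) xor dot s γ

χ : ∀ {n} → Z2n n → Z2n n → ℚ
χ s γ = sign (dot s γ)

xor-cancelʳ : ∀ a b → (a xor b) xor b ≡ a
xor-cancelʳ a b = trans (xor-assoc a b b) (trans (cong (a xor_) (xor-same b)) (xor-identityʳ a))

⊕-cancelʳ : ∀ {n} (γ v : Z2n n) → (γ ⊕ v) ⊕ v ≡ γ
⊕-cancelʳ []      []      = refl
⊕-cancelʳ (c ∷ γ) (b ∷ v) = cong₂ _∷_ (xor-cancelʳ c b) (⊕-cancelʳ γ v)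

⊕-assoc : ∀ {n} (γ u v : Z2n n) → (γ ⊕ u) ⊕ v ≡ γ ⊕ (u ⊕ v)
⊕-assoc = zipWith-assoc xor-assoc

dot-⊕ : ∀ {n} (s γ v : Z2n n) → dot s (γ ⊕ v) ≡ dot s γ xor dot s v
dot-⊕ []      []      []       = refl
dot-⊕ (b ∷ s) (c ∷ γ) (c′ ∷ v) = begin
  (b ∧ (c xor c′)) xor dot s (γ ⊕ v)
    ≡⟨ cong₂ _xor_ (∧-distribˡ-xor b c c′) (dot-⊕ s γ v) ⟩
  ((b ∧ c) xor (b ∧ c′)) xor (dot s γ xor dot s v)
    ≡⟨ xor-interchange (b ∧ c) (b ∧ c′) (dot s γ) (dot s v) ⟩
  ((b ∧ c) xor dot s γ) xor ((b ∧ c′) xor dot s v) ∎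
  where open ≡-Reasoning

dot-allFalse : ∀ {n} (s : Z2n n) → dot s (tabulate λ _ → false) ≡ false
dot-allFalse []      = refl
dot-allFalse (b ∷ s) = cong₂ _xor_ (∧-zeroʳ b) (dot-allFalse s)

π-suc : ∀ {n} (j : Fin n) → π (Fin.suc j) ≡ false ∷ π j
π-suc j = cong (false ∷_) (tabulate-cong λ i → ⌊⌋-map′ _ _ (i Fin.≟ j))

dot-π : ∀ {n} (s : Z2n n) (j : Fin n) → dot s (π j) ≡ lookup s j
dot-π (b ∷ s) Fin.zero    = trans (cong₂ _xor_ (∧-identityʳ b) (dot-allFalse s)) (xor-identityʳ b)
dot-π (b ∷ s) (Fin.suc j) = trans (cong (dot (b ∷ s)) (π-suc j)) (cong₂ _xor_ (∧-zeroʳ b) (dot-π s j))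

χ-⊕ : ∀ {n} (s γ v : Z2n n) → χ s (γ ⊕ v) ≡ χ s γ ℚ.* χ s v
χ-⊕ s γ v = trans (cong sign (dot-⊕ s γ v)) (sign-xor (dot s γ) (dot s v))

χ-π⊕π : ∀ {n} (s : Z2n n) (j k : Fin n) → χ s (π j ⊕ π k) ≡ sign (lookup s j xor lookup s k)
χ-π⊕π s j k = cong sign (trans (dot-⊕ s (π j) (π k)) (cong₂ _xor_ (dot-π s j) (dot-π s k)))

ΣZ2n : (n : ℕ) → (Z2n n → ℚ) → ℚ
ΣZ2n zero    f = f []
ΣZ2n (suc n) f = ΣZ2n n (f ∘ (false ∷_)) ℚ.+ ΣZ2n n (f ∘ (true ∷_))

ΣZ2n-cong : ∀ n {f g : Z2n n → ℚ} → (∀ γ → f γ ≡ g γ) → ΣZ2n n f ≡ ΣZ2n n g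
ΣZ2n-cong zero    f≗g = f≗g []
ΣZ2n-cong (suc n) f≗g = cong₂ ℚ._+_ (ΣZ2n-cong n (f≗g ∘ (false ∷_))) (ΣZ2n-cong n (f≗g ∘ (true ∷_)))

ΣZ2n-zero : ∀ n → ΣZ2n n (λ _ → 0ℚ) ≡ 0ℚ
ΣZ2n-zero zero    = refl
ΣZ2n-zero (suc n) = cong₂ ℚ._+_ (ΣZ2n-zero n) (ΣZ2n-zero n)

ΣZ2n-distrib-+ : ∀ n (f g : Z2n n → ℚ) → ΣZ2n n (λ γ → f γ ℚ.+ g γ) ≡ ΣZ2n n f ℚ.+ ΣZ2n n g
ΣZ2n-distrib-+ zero    f g = refl
ΣZ2n-distrib-+ (suc n) f g = trans
  (cong₂ ℚ._+_ (ΣZ2n-distrib-+ n f₀ g₀) (ΣZ2n-distrib-+ n f₁ g₁))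
  (ℚ-interchange (ΣZ2n n f₀) (ΣZ2n n g₀) (ΣZ2n n f₁) (ΣZ2n n g₁))
  where
  f₀ f₁ g₀ g₁ : Z2n n → ℚ
  f₀ = f ∘ (false ∷_)
  f₁ = f ∘ (true ∷_)
  g₀ = g ∘ (false ∷_)
  g₁ = g ∘ (true ∷_)

*-distribˡ-ΣZ2n : ∀ n c (f : Z2n n → ℚ) → ΣZ2n n (λ γ → c ℚ.* f γ) ≡ c ℚ.* ΣZ2n n f
*-distribˡ-ΣZ2n zero    c f = refl
*-distribˡ-ΣZ2n (suc n) c f = trans
  (cong₂ ℚ._+_ (*-distribˡ-ΣZ2n n c (f ∘ (false ∷_))) (*-distribˡ-ΣZ2n n c (f ∘ (true ∷_))))
  (sym (ℚP.*-distribˡ-+ c _ _))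

ΣZ2n-sum : ∀ n {m} (f : Fin m → Z2n n → ℚ) →
  ΣZ2n n (λ γ → ℚΣ.sum (λ j → f j γ)) ≡ ℚΣ.sum (λ j → ΣZ2n n (f j))
ΣZ2n-sum n {zero}  f = ΣZ2n-zero n
ΣZ2n-sum n {suc m} f = trans (ΣZ2n-distrib-+ n (f Fin.zero) _) (cong (ΣZ2n n (f Fin.zero) ℚ.+_) (ΣZ2n-sum n (f ∘ Fin.suc)))

ΣZ2n-translate : ∀ n (v : Z2n n) (f : Z2n n → ℚ) → ΣZ2n n (λ γ → f (γ ⊕ v)) ≡ ΣZ2n n f
ΣZ2n-translate zero    []          f = refl
ΣZ2n-translate (suc n) (false ∷ v) f =
  cong₂ ℚ._+_ (ΣZ2n-translate n v (f ∘ (false ∷_))) (ΣZ2n-translate n v (f ∘ (true ∷_)))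
ΣZ2n-translate (suc n) (true ∷ v)  f = trans
  (cong₂ ℚ._+_ (ΣZ2n-translate n v (f ∘ (true ∷_))) (ΣZ2n-translate n v (f ∘ (false ∷_))))
  (ℚP.+-comm (ΣZ2n n (f ∘ (true ∷_))) (ΣZ2n n (f ∘ (false ∷_))))

walsh : ∀ n → (Z2n n → ℚ) → Z2n n → ℚ
walsh n M s = ΣZ2n n (λ γ → χ s γ ℚ.* M γ)

walsh-zero : ∀ n {M : Z2n n → ℚ} → (∀ γ → M γ ≡ 0ℚ) → ∀ s → walsh n M s ≡ 0ℚ
walsh-zero n M≡0 s = trans (ΣZ2n-cong n (λ γ → trans (cong (χ s γ ℚ.*_) (M≡0 γ)) (ℚP.*-zeroʳ (χ s γ)))) (ΣZ2n-zero n)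

walsh-translate : ∀ n (M : Z2n n → ℚ) (v s : Z2n n) → walsh n (λ γ → M (γ ⊕ v)) s ≡ χ s v ℚ.* walsh n M s
walsh-translate n M v s = begin
  ΣZ2n n (λ γ → χ s γ ℚ.* M (γ ⊕ v))
    ≡⟨ ΣZ2n-translate n v (λ γ → χ s γ ℚ.* M (γ ⊕ v)) ⟨
  ΣZ2n n (λ γ → χ s (γ ⊕ v) ℚ.* M ((γ ⊕ v) ⊕ v))
    ≡⟨ ΣZ2n-cong n (λ γ → cong₂ ℚ._*_ (χ-⊕ s γ v) (cong M (⊕-cancelʳ γ v))) ⟩
  ΣZ2n n (λ γ → (χ s γ ℚ.* χ s v) ℚ.* M γ)
    ≡⟨ ΣZ2n-cong n (λ γ → ℚ-xy∙z≈y∙xz (χ s γ) (χ s v) (M γ)) ⟩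
  ΣZ2n n (λ γ → χ s v ℚ.* (χ s γ ℚ.* M γ))
    ≡⟨ *-distribˡ-ΣZ2n n (χ s v) _ ⟩
  χ s v ℚ.* walsh n M s ∎
  where open ≡-Reasoning

walsh-sum : ∀ n {m} (f : Fin m → Z2n n → ℚ) (s : Z2n n) →
  walsh n (λ γ → ℚΣ.sum (λ j → f j γ)) s ≡ ℚΣ.sum (λ j → walsh n (f j) s)
walsh-sum n f s = trans (ΣZ2n-cong n (λ γ → ℚΣ.*-distribˡ-sum (χ s γ) (λ j → f j γ)))
                        (ΣZ2n-sum n (λ j γ → χ s γ ℚ.* f j γ))

walsh-true∷ : ∀ n (M : Z2n (suc n) → ℚ) (s : Z2n n) →
  walsh (suc n) M (true ∷ s) ≡ walsh n (M ∘ (false ∷_)) s ℚ.+ ℚ.- 1ℚ ℚ.* walsh n (M ∘ (true ∷_)) s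
walsh-true∷ n M s = cong (walsh n (M ∘ (false ∷_)) s ℚ.+_) (trans
  (ΣZ2n-cong n (λ γ → trans (cong (ℚ._* M (true ∷ γ)) (sign-not (dot s γ)))
                             (ℚP.*-assoc (ℚ.- 1ℚ) (χ s γ) (M (true ∷ γ)))))
  (*-distribˡ-ΣZ2n n (ℚ.- 1ℚ) (λ γ → χ s γ ℚ.* M (true ∷ γ))))

walsh-halves≡0 : ∀ n (M : Z2n (suc n) → ℚ) → (∀ s → walsh (suc n) M s ≡ 0ℚ) →
  ∀ s → walsh n (M ∘ (false ∷_)) s ≡ 0ℚ × walsh n (M ∘ (true ∷_)) s ≡ 0ℚ
walsh-halves≡0 n M walsh≡0 s = sum-and-difference≡0 _ _
  (walsh≡0 (false ∷ s)) (trans (sym (walsh-true∷ n M s)) (walsh≡0 (true ∷ s)))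

walsh≡0⇒≡0 : ∀ n (M : Z2n n → ℚ) → (∀ s → walsh n M s ≡ 0ℚ) → ∀ γ → M γ ≡ 0ℚ
walsh≡0⇒≡0 zero    M walsh≡0 []          = trans (sym (ℚP.*-identityˡ (M []))) (walsh≡0 [])
walsh≡0⇒≡0 (suc n) M walsh≡0 (false ∷ γ) =
  walsh≡0⇒≡0 n (M ∘ (false ∷_)) (proj₁ ∘ walsh-halves≡0 n M walsh≡0) γ
walsh≡0⇒≡0 (suc n) M walsh≡0 (true ∷ γ)  =
  walsh≡0⇒≡0 n (M ∘ (true ∷_)) (proj₂ ∘ walsh-halves≡0 n M walsh≡0) γ

IsSolution : (n : ℕ) → (Z2n n → ℚ) → Set
IsSolution n M = (d : ℕ) → 1 ≤ d → 2 * d ≤ n → (γ : Z2n n) → systemLHS n M d γ ≡ 0ℚ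

signCorrelationTerm : ∀ {n} → Z2n n → ℕ → Fin n → Fin n → ℚ
signCorrelationTerm s d j k = if ⌊ diffMod j k ℕ.≟ d ⌋ then sign (lookup s j xor lookup s k) else 0ℚ

signCorrelation : ∀ {n} → Z2n n → ℕ → ℚ
signCorrelation s d = ℚΣ.sum λ j → ℚΣ.sum (signCorrelationTerm s d j)

systemLHS≡sum : ∀ n M d (γ : Z2n n) → systemLHS n M d γ ≡
  ℚΣ.sum λ j → ℚΣ.sum λ k → if ⌊ diffMod j k ℕ.≟ d ⌋ then M (γ ⊕ (π j ⊕ π k)) else 0ℚ
systemLHS≡sum n M d γ = trans (Σℚ≡sum n _) (ℚΣ.sum-cong-≗ λ j → trans (Σℚ≡sum n _)
  (ℚΣ.sum-cong-≗ λ k → cong (λ δ → if ⌊ diffMod j k ℕ.≟ d ⌋ then M δ else 0ℚ) (⊕-assoc γ (π j) (π k))))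

walsh-systemLHS : ∀ n M d (s : Z2n n) → walsh n (systemLHS n M d) s ≡ signCorrelation s d ℚ.* walsh n M s
walsh-systemLHS n M d s = begin
  walsh n (systemLHS n M d) s
    ≡⟨ ΣZ2n-cong n (λ γ → cong (χ s γ ℚ.*_) (systemLHS≡sum n M d γ)) ⟩
  walsh n (λ γ → ℚΣ.sum λ j → ℚΣ.sum λ k → term j k γ) s
    ≡⟨ walsh-sum n (λ j γ → ℚΣ.sum λ k → term j k γ) s ⟩
  (ℚΣ.sum λ j → walsh n (λ γ → ℚΣ.sum λ k → term j k γ) s)
    ≡⟨ ℚΣ.sum-cong-≗ (λ j → trans (walsh-sum n (term j) s) (ℚΣ.sum-cong-≗ (walsh-term j))) ⟩
  (ℚΣ.sum λ j → ℚΣ.sum λ k → signCorrelationTerm s d j k ℚ.* walsh n M s)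
    ≡⟨ *-distribʳ-sum² (walsh n M s) (signCorrelationTerm s d) ⟨
  signCorrelation s d ℚ.* walsh n M s ∎
  where
  open ≡-Reasoning
  term : Fin n → Fin n → Z2n n → ℚ
  term j k γ = if ⌊ diffMod j k ℕ.≟ d ⌋ then M (γ ⊕ (π j ⊕ π k)) else 0ℚ
  walsh-term : ∀ j k → walsh n (term j k) s ≡ signCorrelationTerm s d j k ℚ.* walsh n M s
  walsh-term j k with ⌊ diffMod j k ℕ.≟ d ⌋
  ... | false = trans (walsh-zero n (λ _ → refl) s) (sym (ℚP.*-zeroˡ (walsh n M s)))
  ... | true  = trans (walsh-translate n M (π j ⊕ π k) s) (cong (ℚ._* walsh n M s) (χ-π⊕π s j k))

systemLHS-χ : ∀ n d (s γ : Z2n n) → systemLHS n (χ s) d γ ≡ χ s γ ℚ.* signCorrelation s d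
systemLHS-χ n d s γ = begin
  systemLHS n (χ s) d γ
    ≡⟨ systemLHS≡sum n (χ s) d γ ⟩
  (ℚΣ.sum λ j → ℚΣ.sum λ k → if ⌊ diffMod j k ℕ.≟ d ⌋ then χ s (γ ⊕ (π j ⊕ π k)) else 0ℚ)
    ≡⟨ ℚΣ.sum-cong-≗ (λ j → ℚΣ.sum-cong-≗ (term j)) ⟩
  (ℚΣ.sum λ j → ℚΣ.sum λ k → χ s γ ℚ.* signCorrelationTerm s d j k)
    ≡⟨ *-distribˡ-sum² (χ s γ) (signCorrelationTerm s d) ⟨
  χ s γ ℚ.* signCorrelation s d ∎
  where
  open ≡-Reasoning
  term : ∀ j k → (if ⌊ diffMod j k ℕ.≟ d ⌋ then χ s (γ ⊕ (π j ⊕ π k)) else 0ℚ)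
                 ≡ χ s γ ℚ.* signCorrelationTerm s d j k
  term j k with ⌊ diffMod j k ℕ.≟ d ⌋
  ... | false = sym (ℚP.*-zeroʳ (χ s γ))
  ... | true  = trans (χ-⊕ s γ (π j ⊕ π k)) (cong (χ s γ ℚ.*_) (χ-π⊕π s j k))

-- Indices live in Fin (suc m), the only case in which diffMod and circulant compute.
module Cyclic (m : ℕ) where

  N : ℕ
  N = suc m

  rotate : Fin N → ℕ → Fin N
  rotate k c = Fin.fromℕ< (m%n<n (toℕ k ℕ.+ c) N)

  toℕ-rotate : ∀ k c → toℕ (rotate k c) ≡ (toℕ k ℕ.+ c) % N
  toℕ-rotate k c = FinP.toℕ-fromℕ< (m%n<n (toℕ k ℕ.+ c) N)

  toℕ%N : ∀ (k : Fin N) → toℕ k % N ≡ toℕ k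
  toℕ%N k = m<n⇒m%n≡m (FinP.toℕ<n k)

  [a%N+b]%N : ∀ a b → (a % N ℕ.+ b) % N ≡ (a ℕ.+ b) % N
  [a%N+b]%N a b = begin
    (a % N ℕ.+ b) % N           ≡⟨ %-distribˡ-+ (a % N) b N ⟩
    (a % N % N ℕ.+ b % N) % N   ≡⟨ cong (λ z → (z ℕ.+ b % N) % N) (m%n%n≡m%n a N) ⟩
    (a % N ℕ.+ b % N) % N       ≡⟨ %-distribˡ-+ a b N ⟨
    (a ℕ.+ b) % N               ∎
    where open ≡-Reasoning

  rotate-rotate : ∀ k a b → rotate (rotate k a) b ≡ rotate k (a ℕ.+ b)
  rotate-rotate k a b = FinP.toℕ-injective (begin
    toℕ (rotate (rotate k a) b)        ≡⟨ toℕ-rotate (rotate k a) b ⟩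
    (toℕ (rotate k a) ℕ.+ b) % N       ≡⟨ cong (λ z → (z ℕ.+ b) % N) (toℕ-rotate k a) ⟩
    ((toℕ k ℕ.+ a) % N ℕ.+ b) % N      ≡⟨ [a%N+b]%N (toℕ k ℕ.+ a) b ⟩
    (toℕ k ℕ.+ a ℕ.+ b) % N            ≡⟨ cong (_% N) (ℕP.+-assoc (toℕ k) a b) ⟩
    (toℕ k ℕ.+ (a ℕ.+ b)) % N          ≡⟨ toℕ-rotate k (a ℕ.+ b) ⟨
    toℕ (rotate k (a ℕ.+ b))           ∎)
    where open ≡-Reasoning

  rotate-N : ∀ k → rotate k N ≡ k
  rotate-N k = FinP.toℕ-injective (trans (toℕ-rotate k N) (trans ([m+n]%n≡m%n (toℕ k) N) (toℕ%N k)))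

  rotate-zero : ∀ k → rotate k 0 ≡ k
  rotate-zero k = FinP.toℕ-injective (trans (toℕ-rotate k 0) (trans (cong (_% N) (ℕP.+-identityʳ (toℕ k))) (toℕ%N k)))

  rotate-inverse : ∀ k {a b} → a ℕ.+ b ≡ N → rotate (rotate k a) b ≡ k
  rotate-inverse k {a} {b} a+b≡N = trans (rotate-rotate k a b) (trans (cong (rotate k) a+b≡N) (rotate-N k))

  rotate-toℕ-comm : ∀ k r → rotate k (toℕ r) ≡ rotate r (toℕ k)
  rotate-toℕ-comm k r = FinP.toℕ-injective (trans (toℕ-rotate k (toℕ r))
    (trans (cong (_% N) (ℕP.+-comm (toℕ k) (toℕ r))) (sym (toℕ-rotate r (toℕ k)))))

  rotate-% : ∀ k c → rotate k (c % N) ≡ rotate k c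
  rotate-% k c = FinP.toℕ-injective (begin
    toℕ (rotate k (c % N))        ≡⟨ toℕ-rotate k (c % N) ⟩
    (toℕ k ℕ.+ c % N) % N         ≡⟨ cong (_% N) (ℕP.+-comm (toℕ k) (c % N)) ⟩
    (c % N ℕ.+ toℕ k) % N         ≡⟨ [a%N+b]%N c (toℕ k) ⟩
    (c ℕ.+ toℕ k) % N             ≡⟨ cong (_% N) (ℕP.+-comm c (toℕ k)) ⟩
    (toℕ k ℕ.+ c) % N             ≡⟨ toℕ-rotate k c ⟨
    toℕ (rotate k c)              ∎)
    where open ≡-Reasoning

  complement : Fin N → ℕ
  complement k = N ∸ toℕ k

  +-complement : ∀ k → toℕ k ℕ.+ complement k ≡ N
  +-complement k = ℕP.m+[n∸m]≡n (ℕP.<⇒≤ (FinP.toℕ<n k))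

  diffMod≡toℕ-rotate : ∀ j k → diffMod j k ≡ toℕ (rotate j (complement k))
  diffMod≡toℕ-rotate j k = sym (toℕ-rotate j (complement k))

  diffMod≡⇒≡rotate : ∀ {d} j k → diffMod j k ≡ d → j ≡ rotate k d
  diffMod≡⇒≡rotate {d} j k diff≡d = begin
    j                                    ≡⟨ rotate-inverse j (trans (ℕP.+-comm (complement k) (toℕ k)) (+-complement k)) ⟨
    rotate (rotate j (complement k)) (toℕ k) ≡⟨ rotate-toℕ-comm k (rotate j (complement k)) ⟨
    rotate k (toℕ (rotate j (complement k))) ≡⟨ cong (rotate k) (trans (sym (diffMod≡toℕ-rotate j k)) diff≡d) ⟩
    rotate k d                           ∎
    where open ≡-Reasoning

  diffMod-rotate : ∀ {d} k → d ℕ.< N → diffMod (rotate k d) k ≡ d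
  diffMod-rotate {d} k d<N = begin
    diffMod (rotate k d) k                    ≡⟨ diffMod≡toℕ-rotate (rotate k d) k ⟩
    toℕ (rotate (rotate k d) (complement k))  ≡⟨ cong toℕ (rotate-rotate k d (complement k)) ⟩
    toℕ (rotate k (d ℕ.+ complement k))       ≡⟨ toℕ-rotate k (d ℕ.+ complement k) ⟩
    (toℕ k ℕ.+ (d ℕ.+ complement k)) % N      ≡⟨ cong (_% N) (ℕ-x∙yz≈y∙xz (toℕ k) d (complement k)) ⟩
    (d ℕ.+ (toℕ k ℕ.+ complement k)) % N      ≡⟨ cong (λ z → (d ℕ.+ z) % N) (+-complement k) ⟩
    (d ℕ.+ N) % N                             ≡⟨ [m+n]%n≡m%n d N ⟩
    d % N                                     ≡⟨ m<n⇒m%n≡m d<N ⟩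
    d                                         ∎
    where open ≡-Reasoning

  sum-rotate : ∀ {c} → c ℕ.≤ N → (f : Fin N → ℤ) → ℤΣ.sum f ≡ ℤΣ.sum (λ k → f (rotate k c))
  sum-rotate {c} c≤N f = ℤΣ.sum-permute f (permutation (λ k → rotate k c) (λ k → rotate k (N ∸ c))
    (λ k → rotate-inverse k (ℕP.m∸n+n≡m c≤N))
    (λ k → rotate-inverse k (ℕP.m+[n∸m]≡n c≤N)))

  autocorrelation : (Fin N → ℤ) → ℕ → ℤ
  autocorrelation x d = ℤΣ.sum λ k → x (rotate k d) ℤ.* x k

  autocorrelation-cong : ∀ {x y : Fin N → ℤ} → (∀ k → x k ≡ y k) → ∀ d → autocorrelation x d ≡ autocorrelation y d
  autocorrelation-cong x≗y d = ℤΣ.sum-cong-≗ λ k → cong₂ ℤ._*_ (x≗y (rotate k d)) (x≗y k)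

  autocorrelation-sym : ∀ x {a b} → a ℕ.+ b ≡ N → autocorrelation x a ≡ autocorrelation x b
  autocorrelation-sym x {a} {b} a+b≡N = begin
    ℤΣ.sum (λ k → x (rotate k a) ℤ.* x k)
      ≡⟨ sum-rotate (subst (b ℕ.≤_) a+b≡N (ℕP.m≤n+m b a)) (λ k → x (rotate k a) ℤ.* x k) ⟩
    ℤΣ.sum (λ k → x (rotate (rotate k b) a) ℤ.* x (rotate k b))
      ≡⟨ ℤΣ.sum-cong-≗ (λ k → cong (λ j → x j ℤ.* x (rotate k b)) (rotate-inverse k {b} (trans (ℕP.+-comm b a) a+b≡N))) ⟩
    ℤΣ.sum (λ k → x k ℤ.* x (rotate k b))
      ≡⟨ ℤΣ.sum-cong-≗ (λ k → ℤP.*-comm (x k) (x (rotate k b))) ⟩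
    ℤΣ.sum (λ k → x (rotate k b) ℤ.* x k) ∎
    where open ≡-Reasoning

  -- circulant x i k unfolds to x (rotate k (complement i)).
  circulant-row-product : ∀ x i i′ →
    Σℤ N (λ k → circulant x i k ℤ.* circulant x i′ k) ≡ autocorrelation x (diffMod i i′)
  circulant-row-product x i i′ = begin
    Σℤ N (λ k → circulant x i k ℤ.* circulant x i′ k)
      ≡⟨ Σℤ≡sum N (λ k → circulant x i k ℤ.* circulant x i′ k) ⟩
    ℤΣ.sum (λ k → circulant x i k ℤ.* circulant x i′ k)
      ≡⟨ sum-rotate (ℕP.<⇒≤ (FinP.toℕ<n i)) (λ k → circulant x i k ℤ.* circulant x i′ k) ⟩
    ℤΣ.sum (λ k → x (rotate (rotate k (toℕ i)) (complement i)) ℤ.* x (rotate (rotate k (toℕ i)) (complement i′)))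
      ≡⟨ ℤΣ.sum-cong-≗ (λ k → cong₂ ℤ._*_ (cong x (rotate-inverse k {toℕ i} (+-complement i)))
                                            (cong x (rotate-to-diff k))) ⟩
    ℤΣ.sum (λ k → x k ℤ.* x (rotate k (diffMod i i′)))
      ≡⟨ ℤΣ.sum-cong-≗ (λ k → ℤP.*-comm (x k) (x (rotate k (diffMod i i′)))) ⟩
    autocorrelation x (diffMod i i′) ∎
    where
    open ≡-Reasoning
    rotate-to-diff : ∀ k → rotate (rotate k (toℕ i)) (complement i′) ≡ rotate k (diffMod i i′)
    rotate-to-diff k = trans (rotate-rotate k (toℕ i) (complement i′)) (sym (rotate-% k (toℕ i ℕ.+ complement i′)))

  1≤d⇒2d≤N⇒d<N : ∀ {d} → 1 ≤ d → 2 * d ≤ N → d < N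
  1≤d⇒2d≤N⇒d<N {d} 1≤d 2d≤N = ℕP.<-≤-trans (ℕP.m<m+n d (ℕP.≤-trans 1≤d (ℕP.m≤m+n d 0))) 2d≤N

  IsPerfect : (Fin N → ℤ) → Set
  IsPerfect x = ∀ d → 1 ≤ d → 2 * d ≤ N → autocorrelation x d ≡ 0ℤ

  2*[N∸e]≤N : ∀ {e} → e < N → ¬ (2 * e ≤ N) → 2 * (N ∸ e) ≤ N
  2*[N∸e]≤N {zero}      _   2e≰N = ⊥-elim (2e≰N ℕ.z≤n)
  2*[N∸e]≤N {e@(suc _)} e<N 2e≰N = begin
    2 * (N ∸ e)              ≡⟨ cong ((N ∸ e) ℕ.+_) (ℕP.+-identityʳ (N ∸ e)) ⟩
    (N ∸ e) ℕ.+ (N ∸ e)      ≤⟨ ℕP.+-monoʳ-≤ (N ∸ e) (ℕP.<⇒≤ N∸e<e) ⟩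
    (N ∸ e) ℕ.+ e            ≡⟨ ℕP.m∸n+n≡m (ℕP.<⇒≤ e<N) ⟩
    N                        ∎
    where
    open ℕP.≤-Reasoning
    N∸e<e : N ∸ e < e
    N∸e<e = ℕP.m<n+o⇒m∸n<o N e (subst (N <_) (cong (e ℕ.+_) (ℕP.+-identityʳ e)) (ℕP.≰⇒> 2e≰N))

  perfect⇒autocorrelation≡0 : ∀ x → IsPerfect x → ∀ {e} → 1 ≤ e → e < N → autocorrelation x e ≡ 0ℤ
  perfect⇒autocorrelation≡0 x perfect {e} 1≤e e<N with 2 * e ℕ.≤? N
  ... | yes 2e≤N = perfect e 1≤e 2e≤N
  ... | no  2e≰N = trans (autocorrelation-sym x (ℕP.m+[n∸m]≡n (ℕP.<⇒≤ e<N)))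
                         (perfect (N ∸ e) (ℕP.m<n⇒0<n∸m e<N) (2*[N∸e]≤N e<N 2e≰N))

  1≤diffMod : ∀ {i i′} → i ≢ i′ → 1 ≤ diffMod i i′
  1≤diffMod {i} {i′} i≢i′ =
    ℕP.n≢0⇒n>0 λ diff≡0 → i≢i′ (trans (diffMod≡⇒≡rotate i i′ diff≡0) (rotate-zero i′))

  circulant-isHadamard : ∀ {x} → (∀ k → IsSign (x k)) → IsPerfect x → IsHadamard N (circulant x)
  circulant-isHadamard {x} x-signs perfect = (λ i j → x-signs _) , λ i i′ i≢i′ →
    trans (circulant-row-product x i i′)
          (perfect⇒autocorrelation≡0 x perfect (1≤diffMod i≢i′) (m%n<n (toℕ i ℕ.+ complement i′) N))

  isHadamard⇒isSign : ∀ x → IsHadamard N (circulant x) → ∀ k → IsSign (x k)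
  isHadamard⇒isSign x (entries , _) k = subst (IsSign ∘ x) (rotate-N k) (entries Fin.zero k)

  isHadamard⇒perfect : ∀ x → IsHadamard N (circulant x) → IsPerfect x
  isHadamard⇒perfect x (_ , orthogonal) d 1≤d 2d≤N = begin
    autocorrelation x d                  ≡⟨ cong (autocorrelation x) (diffMod-rotate Fin.zero d<N) ⟨
    autocorrelation x (diffMod i Fin.zero) ≡⟨ circulant-row-product x i Fin.zero ⟨
    Σℤ N (λ k → circulant x i k ℤ.* circulant x Fin.zero k) ≡⟨ orthogonal i Fin.zero i≢0 ⟩
    0ℤ                                   ∎
    where
    open ≡-Reasoning
    d<N : d < N
    d<N = 1≤d⇒2d≤N⇒d<N 1≤d 2d≤N
    i : Fin N
    i = rotate Fin.zero d
    i≢0 : i ≢ Fin.zero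
    i≢0 i≡0 = ℕP.<⇒≢ 1≤d (sym (begin
      d                              ≡⟨ diffMod-rotate Fin.zero d<N ⟨
      diffMod i Fin.zero             ≡⟨ cong (λ j → diffMod j Fin.zero) i≡0 ⟩
      diffMod {N} Fin.zero Fin.zero  ≡⟨ n%n≡0 N ⟩
      0                              ∎))

  circulantHadamard⇔perfect : CirculantHadamardExists N ⇔ (Σ[ s ∈ Z2n N ] IsPerfect (signs s))
  circulantHadamard⇔perfect = mk⇔ to from
    where
    to : CirculantHadamardExists N → Σ[ s ∈ Z2n N ] IsPerfect (signs s)
    to (witness x H) = s , λ d 1≤d 2d≤N → trans (sym (autocorrelation-cong x≗signs d)) (isHadamard⇒perfect x H d 1≤d 2d≤N)
      where
      s : Z2n N
      s = tabulate λ k → ⌊ x k ℤ.≟ ℤ.-1ℤ ⌋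
      x≗signs : ∀ k → x k ≡ signs s k
      x≗signs k = trans (isSign⇒≡signℤ (isHadamard⇒isSign x H k))
                        (cong signℤ (sym (lookup∘tabulate (λ k → ⌊ x k ℤ.≟ ℤ.-1ℤ ⌋) k)))
    from : Σ[ s ∈ Z2n N ] IsPerfect (signs s) → CirculantHadamardExists N
    from (s , perfect) = witness (signs s) (circulant-isHadamard (signℤ-isSign ∘ lookup s) perfect)

  signCorrelation≡autocorrelation : ∀ s {d} → d < N → signCorrelation s d ≡ fromℤ (autocorrelation (signs s) d)
  signCorrelation≡autocorrelation s {d} d<N = begin
    signCorrelation s d
      ≡⟨ ℚΣ.∑-comm (signCorrelationTerm s d) ⟩
    (ℚΣ.sum λ k → ℚΣ.sum λ j → signCorrelationTerm s d j k)
      ≡⟨ ℚΣ.sum-cong-≗ (λ k → sum-select (λ j → diffMod j k ℕ.≟ d) (λ j → sign (lookup s j xor lookup s k))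
                                  (diffMod≡⇒≡rotate _ k) (diffMod-rotate k d<N)) ⟩
    (ℚΣ.sum λ k → sign (lookup s (rotate k d) xor lookup s k))
      ≡⟨ ℚΣ.sum-cong-≗ (λ k → sign-xor≡fromℤ (lookup s (rotate k d)) (lookup s k)) ⟩
    (ℚΣ.sum λ k → fromℤ (signs s (rotate k d) ℤ.* signs s k))
      ≡⟨ fromℤ-sum (λ k → signs s (rotate k d) ℤ.* signs s k) ⟨
    fromℤ (autocorrelation (signs s) d) ∎
    where open ≡-Reasoning

  walsh≢0⇒perfect : ∀ M → IsSolution N M → ∀ s → walsh N M s ≢ 0ℚ → IsPerfect (signs s)
  walsh≢0⇒perfect M solution s walsh≢0 d 1≤d 2d≤N = fromℤ-injective (begin
    fromℤ (autocorrelation (signs s) d) ≡⟨ signCorrelation≡autocorrelation s (1≤d⇒2d≤N⇒d<N 1≤d 2d≤N) ⟨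
    signCorrelation s d                 ≡⟨ p*q≡0⇒q≢0⇒p≡0 walsh-equation walsh≢0 ⟩
    0ℚ                                  ∎)
    where
    open ≡-Reasoning
    walsh-equation : signCorrelation s d ℚ.* walsh N M s ≡ 0ℚ
    walsh-equation = trans (sym (walsh-systemLHS N M d s)) (walsh-zero N (solution d 1≤d 2d≤N) s)

  χ-isSolution : ∀ s → IsPerfect (signs s) → IsSolution N (χ s)
  χ-isSolution s perfect d 1≤d 2d≤N γ = begin
    systemLHS N (χ s) d γ          ≡⟨ systemLHS-χ N d s γ ⟩
    χ s γ ℚ.* signCorrelation s d
      ≡⟨ cong (χ s γ ℚ.*_) (signCorrelation≡autocorrelation s (1≤d⇒2d≤N⇒d<N 1≤d 2d≤N)) ⟩
    χ s γ ℚ.* fromℤ (autocorrelation (signs s) d)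
      ≡⟨ cong (λ z → χ s γ ℚ.* fromℤ z) (perfect d 1≤d 2d≤N) ⟩
    χ s γ ℚ.* 0ℚ
      ≡⟨ ℚP.*-zeroʳ (χ s γ) ⟩
    0ℚ ∎
    where open ≡-Reasoning

lemma3 : (n : ℕ) → 1 ≤ n →
    (¬ CirculantHadamardExists n) ⇔
    ((M : Z2n n → ℚ) →
      ((d : ℕ) → 1 ≤ d → 2 * d ≤ n → (γ : Z2n n) → systemLHS n M d γ ≡ 0ℚ) →
      (γ : Z2n n) → M γ ≡ 0ℚ)
lemma3 (suc m) _ = mk⇔ onlyTrivialSolution noCirculantHadamard
  where
  open Cyclic m
  onlyTrivialSolution : ¬ CirculantHadamardExists N → ∀ M → IsSolution N M → ∀ γ → M γ ≡ 0ℚ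
  onlyTrivialSolution noHadamard M solution = walsh≡0⇒≡0 N M walsh≡0
    where
    walsh≡0 : ∀ s → walsh N M s ≡ 0ℚ
    walsh≡0 s with walsh N M s ℚ.≟ 0ℚ
    ... | yes ≡0 = ≡0
    ... | no  ≢0 = ⊥-elim (noHadamard (Equivalence.from circulantHadamard⇔perfect (s , walsh≢0⇒perfect M solution s ≢0)))
  noCirculantHadamard : (∀ M → IsSolution N M → ∀ γ → M γ ≡ 0ℚ) → ¬ CirculantHadamardExists N
  noCirculantHadamard onlyTrivial hadamard with Equivalence.to circulantHadamard⇔perfect hadamard
  ... | s , perfect = sign≢0 (dot s zeros) (onlyTrivial (χ s) (χ-isSolution s perfect) zeros)
    where
    zeros : Z2n N
    zeros = replicate N false
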